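{- Let $A,B$ be an instance of $2$-Max-Duo and let $G=(V,E)$ be the graph constructed from it as described in the context. Then: (1) for each index $i$ there are at most two distinct indices $j$ such that $v_{i,j}\in V$; (2) if $v_{i,j},v_{i,j'}\in V$ with $j'\ne j$, and $v_{i+1,j''+1}\in V$ (or symmetrically $v_{i-1,j''-1}\in V$), then $j''=j$ or $j''=j'$.
   Context: $A=(a_1,\dots,a_n)$ and $B=(b_1,\dots,b_n)$ are strings such that $B$ is a permutation of $A$, and every letter occurs at most twice in each of $A$ and $B$ (this is an instance of $2$-Max-Duo). $H=(A,B,F)$ is the bipartite graph with vertex classes $a_1,\dots,a_n$ and $b_1,\dots,b_n$, and an edge $e_{i,j}$ between $a_i$ and $b_j$ if and only if the letters $a_i$ and $b_j$ are equal. $G=(V,E)$ has vertex set $V=\{v_{i,j}: 1\le i,j\le n-1,\ e_{i,j},e_{i+1,j+1}\in F\}$. Two distinct vertices are adjacent if and only if their corresponding pairs of edges $(e_{i,j},e_{i+1,j+1})$ cannot both be contained in a common perfect matching of $H$. -}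

module Defs where

open import Data.Nat using (ℕ; suc; _≤_)
open import Data.Fin using (Fin; inject₁) renaming (suc to fsuc)
open import Data.Vec using (Vec; lookup; count; toList)
open import Data.Product using (_×_)
open import Relation.Binary.PropositionalEquality using (_≡_)
open import Relation.Binary.Definitions using (DecidableEquality)
open import Data.List.Relation.Binary.Permutation.Propositional using (_↭_)

AtMostTwice : {Σ : Set} → DecidableEquality Σ → {n : ℕ} → Vec Σ n → Set
AtMostTwice {Σ} _≟_ s = (c : Σ) → count (_≟ c) s ≤ 2

record TwoMaxDuo {Σ : Set} (_≟_ : DecidableEquality Σ) {n : ℕ} (A B : Vec Σ n) : Set where
  field
    perm   : toList B ↭ toList A
    twiceA : AtMostTwice _≟_ A
    twiceB : AtMostTwice _≟_ B

-- Strings have length n = suc m. Vertex indices i j : Fin m (0-based) stand for the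
-- 1-based v_{i+1,j+1}, 1 ≤ i+1, j+1 ≤ n-1.  v_{i,j} ∈ V iff e_{i,j}, e_{i+1,j+1} ∈ F,
-- i.e. a_i = b_j and a_{i+1} = b_{j+1}.
InV : {Σ : Set} {m : ℕ} → Vec Σ (suc m) → Vec Σ (suc m) → Fin m → Fin m → Set
InV A B i j =
  (lookup A (inject₁ i) ≡ lookup B (inject₁ j)) ×
  (lookup A (fsuc i) ≡ lookup B (fsuc j))

-- Everything rests on one counting fact: if a decidable predicate P holds at
-- three pairwise distinct positions of a vector, then count P? of the vector is
-- at least 3.  It follows from removing a position where P holds, which lowers
-- the count by exactly one while keeping the other positions (via punchOut)
-- distinct.  Consequently, in a string in which every letter occurs at most
-- twice, three positions carrying the same letter cannot be pairwise distinct.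
--
-- Both parts of the lemma are applications of this to the string B:
--  (1) all j with v_{i,j} ∈ V satisfy b_j = a_i, so there are at most two;
--  (2) if v_{i,j}, v_{i,j′} ∈ V with j ≠ j′ then b_{j+1} = b_{j′+1} = a_{i+1},
--      and any v_{i+1,k} ∈ V has b_k = a_{i+1}, so k ∈ {j+1, j′+1};
--      symmetrically a vertex v_{i-1,k} has b_{k+1} = a_i = b_j = b_{j′}.
module Submission where

open import Defs
open import Data.Nat using (ℕ; suc; _≤_; z≤n; s≤s)
open import Data.Nat.Properties using (≤-trans)
open import Data.Fin using (Fin; toℕ; inject₁; punchOut) renaming (zero to fzero; suc to fsuc)
open import Data.Fin.Properties using (toℕ-injective; toℕ-inject₁; inject₁-injective; suc-injective; punchOut-injective)
  renaming (_≟_ to _≟ᶠ_)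
open import Data.Vec using (Vec; lookup; count; removeAt; _∷_)
open import Data.Vec.Properties using (removeAt-punchOut)
open import Data.Product using (_×_; _,_)
open import Data.Sum using (_⊎_; inj₁; inj₂)
open import Function using (_∘_)
open import Relation.Nullary using (¬_; yes; no; contradiction)
open import Relation.Unary using (Pred; Decidable)
open import Relation.Binary.PropositionalEquality using (_≡_; _≢_; refl; sym; trans; cong)
open import Relation.Binary.Definitions using (DecidableEquality)

module Occurrences {a p} {A : Set a} {P : Pred A p} (P? : Decidable P) where

  count-removeAt : ∀ {n} (xs : Vec A (suc n)) i → P (lookup xs i) →
                   count P? xs ≡ suc (count P? (removeAt xs i))
  count-removeAt (x ∷ xs) fzero px with P? x
  ... | yes _ = refl
  ... | no ¬px = contradiction px ¬px
  count-removeAt (x ∷ xs@(_ ∷ _)) (fsuc i) pxs with P? x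
  ... | yes _ = cong suc (count-removeAt xs i pxs)
  ... | no _ = count-removeAt xs i pxs

  one-occurrence : ∀ {n} (xs : Vec A n) i → P (lookup xs i) → 1 ≤ count P? xs
  one-occurrence {suc _} xs i pi rewrite count-removeAt xs i pi = s≤s z≤n

  two-occurrences : ∀ {n} (xs : Vec A n) {i j} → i ≢ j →
                    P (lookup xs i) → P (lookup xs j) → 2 ≤ count P? xs
  two-occurrences {suc _} xs {i} {j} i≢j pi pj rewrite count-removeAt xs i pi =
    s≤s (one-occurrence (removeAt xs i) (punchOut i≢j) pj′)
    where
    pj′ : P (lookup (removeAt xs i) (punchOut i≢j))
    pj′ rewrite removeAt-punchOut xs i≢j = pj

  three-occurrences : ∀ {n} (xs : Vec A n) {i j k} → i ≢ j → i ≢ k → j ≢ k →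
                      P (lookup xs i) → P (lookup xs j) → P (lookup xs k) → 3 ≤ count P? xs
  three-occurrences {suc _} xs {i} {j} {k} i≢j i≢k j≢k pi pj pk
    rewrite count-removeAt xs i pi =
    s≤s (two-occurrences (removeAt xs i) j′≢k′ pj′ pk′)
    where
    j′≢k′ : punchOut i≢j ≢ punchOut i≢k
    j′≢k′ = j≢k ∘ punchOut-injective i≢j i≢k
    pj′ : P (lookup (removeAt xs i) (punchOut i≢j))
    pj′ rewrite removeAt-punchOut xs i≢j = pj
    pk′ : P (lookup (removeAt xs i) (punchOut i≢k))
    pk′ rewrite removeAt-punchOut xs i≢k = pk

  at-most-two-positions : ∀ {n} (xs : Vec A n) → count P? xs ≤ 2 → ∀ i j k →
                          P (lookup xs i) → P (lookup xs j) → P (lookup xs k) →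
                          (i ≡ j) ⊎ (i ≡ k) ⊎ (j ≡ k)
  at-most-two-positions xs bound i j k pi pj pk with i ≟ᶠ j | i ≟ᶠ k | j ≟ᶠ k
  ... | yes i≡j | _ | _ = inj₁ i≡j
  ... | no _ | yes i≡k | _ = inj₂ (inj₁ i≡k)
  ... | no _ | no _ | yes j≡k = inj₂ (inj₂ j≡k)
  ... | no i≢j | no i≢k | no j≢k
    with ≤-trans (three-occurrences xs i≢j i≢k j≢k pi pj pk) bound
  ... | s≤s (s≤s ())

module Letters {Σ : Set} (_≟_ : DecidableEquality Σ) {n : ℕ} {s : Vec Σ n}
               (twice : AtMostTwice _≟_ s) where

  third-position : ∀ {c j j′ k} → j ≢ j′ →
                   lookup s j ≡ c → lookup s j′ ≡ c → lookup s k ≡ c → (k ≡ j) ⊎ (k ≡ j′)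
  third-position {c} {j} {j′} {k} j≢j′ sj sj′ sk
    with Occurrences.at-most-two-positions (_≟ c) s (twice c) j j′ k sj sj′ sk
  ... | inj₁ j≡j′ = contradiction j≡j′ j≢j′
  ... | inj₂ (inj₁ j≡k) = inj₁ (sym j≡k)
  ... | inj₂ (inj₂ j′≡k) = inj₂ (sym j′≡k)

inject₁-successor : ∀ {m} {i i′ : Fin m} → toℕ i′ ≡ suc (toℕ i) → inject₁ i′ ≡ fsuc i
inject₁-successor {i′ = i′} i′≡1+i = toℕ-injective (trans (toℕ-inject₁ i′) i′≡1+i)

lemma2p3 : {Σ : Set} (_≟_ : DecidableEquality Σ) (m : ℕ) (A B : Vec Σ (suc m)) →
    TwoMaxDuo _≟_ A B →
    ((i j₁ j₂ j₃ : Fin m) → InV A B i j₁ → InV A B i j₂ → InV A B i j₃ →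
       (j₁ ≡ j₂) ⊎ (j₁ ≡ j₃) ⊎ (j₂ ≡ j₃))
    ×
    ((i j j′ : Fin m) → InV A B i j → InV A B i j′ → ¬ (j ≡ j′) →
       ((i′ k : Fin m) → toℕ i′ ≡ suc (toℕ i) → InV A B i′ k →
          (toℕ k ≡ suc (toℕ j)) ⊎ (toℕ k ≡ suc (toℕ j′)))
       ×
       ((i′ k : Fin m) → suc (toℕ i′) ≡ toℕ i → InV A B i′ k →
          (suc (toℕ k) ≡ toℕ j) ⊎ (suc (toℕ k) ≡ toℕ j′)))
lemma2p3 _≟_ m A B instance′ = row-at-most-two , neighbours
  where
  open TwoMaxDuo instance′ using (twiceB)
  open Letters _≟_ {s = B} twiceB using (third-position)

  -- (1) every j in row i marks an occurrence of the letter a_i in B.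
  row-at-most-two : (i j₁ j₂ j₃ : Fin m) → InV A B i j₁ → InV A B i j₂ → InV A B i j₃ →
                    (j₁ ≡ j₂) ⊎ (j₁ ≡ j₃) ⊎ (j₂ ≡ j₃)
  row-at-most-two i j₁ j₂ j₃ (a≡b₁ , _) (a≡b₂ , _) (a≡b₃ , _)
    with Occurrences.at-most-two-positions (_≟ lookup A (inject₁ i)) B (twiceB _)
           (inject₁ j₁) (inject₁ j₂) (inject₁ j₃) (sym a≡b₁) (sym a≡b₂) (sym a≡b₃)
  ... | inj₁ e = inj₁ (inject₁-injective e)
  ... | inj₂ (inj₁ e) = inj₂ (inj₁ (inject₁-injective e))
  ... | inj₂ (inj₂ e) = inj₂ (inj₂ (inject₁-injective e))

  -- (2) the letters a_{i+1} (resp. a_i) occupy b_{j+1}, b_{j′+1} (resp. b_j, b_{j′}).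
  neighbours : (i j j′ : Fin m) → InV A B i j → InV A B i j′ → ¬ (j ≡ j′) →
               ((i′ k : Fin m) → toℕ i′ ≡ suc (toℕ i) → InV A B i′ k →
                  (toℕ k ≡ suc (toℕ j)) ⊎ (toℕ k ≡ suc (toℕ j′)))
               ×
               ((i′ k : Fin m) → suc (toℕ i′) ≡ toℕ i → InV A B i′ k →
                  (suc (toℕ k) ≡ toℕ j) ⊎ (suc (toℕ k) ≡ toℕ j′))
  neighbours i j j′ (a≡b , a⁺≡b⁺) (a≡b′ , a⁺≡b′⁺) j≢j′ = next-row , previous-row
    where
    next-row : (i′ k : Fin m) → toℕ i′ ≡ suc (toℕ i) → InV A B i′ k →
               (toℕ k ≡ suc (toℕ j)) ⊎ (toℕ k ≡ suc (toℕ j′))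
    next-row i′ k i′≡1+i (a′≡bₖ , _)
      with third-position (j≢j′ ∘ suc-injective) (sym a⁺≡b⁺) (sym a⁺≡b′⁺)
             (trans (sym a′≡bₖ) (cong (lookup A) (inject₁-successor i′≡1+i)))
    ... | inj₁ e = inj₁ (trans (sym (toℕ-inject₁ k)) (cong toℕ e))
    ... | inj₂ e = inj₂ (trans (sym (toℕ-inject₁ k)) (cong toℕ e))

    previous-row : (i′ k : Fin m) → suc (toℕ i′) ≡ toℕ i → InV A B i′ k →
                   (suc (toℕ k) ≡ toℕ j) ⊎ (suc (toℕ k) ≡ toℕ j′)
    previous-row i′ k 1+i′≡i (_ , a′⁺≡bₖ⁺)
      with third-position (j≢j′ ∘ inject₁-injective) (sym a≡b) (sym a≡b′)
             (trans (sym a′⁺≡bₖ⁺) (cong (lookup A) (sym (inject₁-successor (sym 1+i′≡i)))))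
    ... | inj₁ e = inj₁ (trans (cong toℕ e) (toℕ-inject₁ j))
    ... | inj₂ e = inj₂ (trans (cong toℕ e) (toℕ-inject₁ j′))
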